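{- Let $a\geqslant 2$ and $b\geqslant 0$ be integers, and let $\pi\in\mathfrak{S}_n$ contain at least one pattern from $\Pi(a-1,b+1)$. Then the $a-1$ elements associated with $\underline{a}$ are exactly the entries of $\pi$ whose values lie in the interval $[\underline{a-1},\,\underline{a}-1]$; in particular they form an interval of values.
   Context: Permutations are written in one-line notation $\pi=\pi_1\ldots\pi_n$; $\mathfrak{S}_n$ is the set of permutations of size $n$. A permutation $\pi$ contains a pattern $\rho$ of size $k$ if there are indices $i_1<\dots<i_k$ with $\pi_{i_1}\ldots\pi_{i_k}$ order-isomorphic to $\rho$ (an occurrence of $\rho$); otherwise $\pi$ avoids $\rho$. In such an occurrence, the entry $\pi_{i_j}$ is said to play the role of the value $\rho_j$. $[x,y]$ denotes the set of integers $z$ with $x\leqslant z\leqslant y$, and $\iota_k$ is the increasing permutation $12\ldots k$. For integers $c\geqslant 1$, $d\geqslant 0$ with $c+d\geqslant 2$, the partial shuffle $\Pi(c,d)$ is the set of permutations of size $c+d$ obtained by writing the elements of $[c+d]\setminus\{c\}$ in increasing order and inserting $c$ into every possible position except the one that yields $\iota_{c+d}$ (e.g. $\Pi(3,2)=\{12453,12435,13245,31245\}$). If $\pi$ contains some pattern from $\Pi(a-1,b+1)$, then $\underline{a}$ denotes the smallest value of an entry of $\pi$ that plays the role of $a$ in some occurrence in $\pi$ of some pattern from $\Pi(a-1,b+1)$. An entry of $\pi$ is an $a-1$ element associated with $\underline{a}$ if it plays the role of $a-1$ in some occurrence of a pattern from $\Pi(a-1,b+1)$ in which the entry of value $\underline{a}$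 plays the role of $a$; $\underline{a-1}$ denotes the smallest value of such an entry. -}

module Defs where

open import Data.Nat using (ℕ; zero; suc; _+_; _∸_; _<_; _≤_; _<ᵇ_; _≡ᵇ_)
open import Data.Fin using (Fin; toℕ)
import Data.Fin as F
open import Data.Bool using (if_then_else_)
open import Data.Product using (Σ; ∃; _×_)
open import Relation.Binary.PropositionalEquality using (_≡_)
open import Relation.Nullary using (¬_)
open import Function.Definitions using (Injective)
open import Function.Bundles using (_⇔_)

-- A permutation of size n: an injective (hence bijective) map Fin n → Fin n,
-- position i ↦ (value − 1).
record Perm (n : ℕ) : Set where
  field
    fn  : Fin n → Fin n
    inj : Injective _≡_ _≡_ fn
open Perm public

val : ∀ {n} → Perm n → Fin n → ℕ
val π i = suc (toℕ (fn π i))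

record Occurrence {n k : ℕ} (π : Perm n) (ρ : Fin k → ℕ) : Set where
  field
    pos     : Fin k → Fin n
    incr    : ∀ i j → i F.< j → pos i F.< pos j
    orderIso : ∀ i j → (ρ i < ρ j) ⇔ (val π (pos i) < val π (pos j))
open Occurrence public

-- [c+d] \ {c} in increasing order, j-th element (0-based j)
skipVal : ℕ → ℕ → ℕ
skipVal c j = if suc j <ᵇ c then suc j else suc (suc j)

-- insert c at (0-based) position p into the increasing word of [c+d] \ {c}
insertAt : ℕ → ℕ → ℕ → ℕ
insertAt c p i =
  if i <ᵇ p then skipVal c i
  else (if i ≡ᵇ p then c else skipVal c (i ∸ 1))

shufflePat : (c d p : ℕ) → Fin (c + d) → ℕ
shufflePat c d p i = insertAt c p (toℕ i)

-- Admissible positions: p ∈ [0, c+d−1] and p ≠ c−1 (which would give ι_{c+d})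
ValidPos : ℕ → ℕ → ℕ → Set
ValidPos c d p = (p < c + d) × ¬ (p ≡ c ∸ 1)

ContainsΠ : ∀ {n} → Perm n → ℕ → ℕ → Set
ContainsΠ π c d = Σ ℕ λ p → ValidPos c d p × Occurrence π (shufflePat c d p)

RolesIn : ∀ {n} → Perm n → (c d u x v y : ℕ) → Set
RolesIn {n} π c d u x v y =
  Σ ℕ λ p → ValidPos c d p × Σ (Occurrence π (shufflePat c d p)) λ o →
    (Σ (Fin (c + d)) λ j → shufflePat c d p j ≡ u × val π (pos o j) ≡ x) ×
    (Σ (Fin (c + d)) λ j → shufflePat c d p j ≡ v × val π (pos o j) ≡ y)

PlaysA : ∀ {n} → Perm n → (a b x : ℕ) → Set
PlaysA π a b x = RolesIn π (a ∸ 1) (suc b) a x a x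

AssocWith : ∀ {n} → Perm n → (a b ua y : ℕ) → Set
AssocWith π a b ua y = RolesIn π (a ∸ 1) (suc b) a ua (a ∸ 1) y

IsMin : (ℕ → Set) → ℕ → Set
IsMin P m = P m × (∀ x → P x → m ≤ x)

-- Write k = a − 2. An occurrence of a pattern of Π(a−1, b+1) is a chain s₀, …, s_{k+b}, increasing
-- in position and value (the entries playing 1, …, a−2, a, …, a+b), together with an extra entry e
-- (playing a−1) which lies between s_{k−1} and s_k by value, and in any gap of the chain except that
-- one by position. Take an occurrence with s_k = ua and e = ua1, and an entry v with ua1 ≤ v < ua.
-- By value v fits wherever e does, so if its position lies in an allowed gap it can replace e.
-- Otherwise v lies between s_{k−1} and s_k by position as well, and (if v ≠ e) it can replace s_k
-- while e stays the extra entry: either this is an occurrence in which v < ua plays a, contradicting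
-- the minimality of ua, or e falls into the forbidden gap of the new chain, hence also into the
-- forbidden gap of the old one.
module Submission where

open import Defs
open import Data.Nat
  using (ℕ; zero; suc; _+_; _∸_; _<_; _≤_; _<ᵇ_; _≡ᵇ_; z≤n; s≤s; z<s; s<s; s≤s⁻¹; s<s⁻¹; _≟_; _<?_)
open import Data.Nat.Properties
open import Data.Fin using (Fin; toℕ; fromℕ<)
import Data.Fin.Properties as Fin
open import Data.Bool using (T; true; false; if_then_else_)
open import Data.Bool.Properties using (if-float; T-≡)
open import Data.Maybe using (Maybe; just; nothing; maybe′)
open import Data.Maybe.Relation.Unary.All using (All; just; nothing)
open import Data.Product using (Σ; _×_; _,_)
open import Data.Sum using (inj₁; inj₂)
open import Data.Unit using (tt)
open import Data.Empty using (⊥; ⊥-elim)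
open import Function using (_∘_)
open import Function.Bundles using (_⇔_; mk⇔; Equivalence)
open import Relation.Binary.Definitions using (tri<; tri≈; tri>)
open import Relation.Binary.PropositionalEquality
open import Relation.Nullary using (yes; no; contradiction)

private variable
  A : Set
  f : A → ℕ
  s : ℕ → A
  e x : A
  i j m p q t : ℕ
  α β : Maybe ℕ

<ᵇ-true : i < j → (i <ᵇ j) ≡ true
<ᵇ-true = Equivalence.to T-≡ ∘ <⇒<ᵇ

<ᵇ-false : j ≤ i → (i <ᵇ j) ≡ false
<ᵇ-false {j} {i} j≤i with i <ᵇ j in eq
... | false = refl
... | true  = contradiction (<ᵇ⇒< i j (subst T (sym eq) tt)) (≤⇒≯ j≤i)

≡ᵇ-refl : ∀ i → (i ≡ᵇ i) ≡ true
≡ᵇ-refl i = Equivalence.to T-≡ (≡⇒≡ᵇ i i refl)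

≡ᵇ-false : i ≢ j → (i ≡ᵇ j) ≡ false
≡ᵇ-false {i} {j} i≢j with i ≡ᵇ j in eq
... | false = refl
... | true  = contradiction (≡ᵇ⇒≡ i j (subst T (sym eq) tt)) i≢j

skip : ℕ → ℕ → ℕ
skip p i = if i <ᵇ p then i else suc i

skip-below : i < p → skip p i ≡ i
skip-below i<p rewrite <ᵇ-true i<p = refl

skip-above : p ≤ i → skip p i ≡ suc i
skip-above p≤i rewrite <ᵇ-false p≤i = refl

skip≤suc : ∀ p i → skip p i ≤ suc i
skip≤suc p i with i <? p
... | yes i<p rewrite skip-below i<p = n≤1+n i
... | no  i≮p rewrite skip-above (≮⇒≥ i≮p) = ≤-refl

skip-<-pivot : i < p → skip p i < p
skip-<-pivot i<p rewrite skip-below i<p = i<p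

pivot-<-skip : p ≤ i → p < skip p i
pivot-<-skip p≤i rewrite skip-above p≤i = s≤s p≤i

skip-<-pivot⁻¹ : skip p i < p → i < p
skip-<-pivot⁻¹ {p} {i} lt with i <? p
... | yes i<p = i<p
... | no  i≮p = contradiction lt (<⇒≯ (pivot-<-skip (≮⇒≥ i≮p)))

pivot-<-skip⁻¹ : p < skip p i → p ≤ i
pivot-<-skip⁻¹ {p} {i} lt with i <? p
... | yes i<p = contradiction lt (<⇒≯ (skip-<-pivot i<p))
... | no  i≮p = ≮⇒≥ i≮p

skip≢pivot : skip p i ≢ p
skip≢pivot {p} {i} eq with i <? p
... | yes i<p = <⇒≢ (skip-<-pivot i<p) eq
... | no  i≮p = >⇒≢ (pivot-<-skip (≮⇒≥ i≮p)) eq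

skip-mono-< : ∀ p → i < j → skip p i < skip p j
skip-mono-< {i} {j} p i<j with i <? p | j <? p
... | yes i<p | yes j<p rewrite skip-below i<p | skip-below j<p = i<j
... | yes i<p | no  j≮p rewrite skip-below i<p | skip-above (≮⇒≥ j≮p) = m<n⇒m<1+n i<j
... | no  i≮p | yes j<p = contradiction (<-trans i<j j<p) i≮p
... | no  i≮p | no  j≮p rewrite skip-above (≮⇒≥ i≮p) | skip-above (≮⇒≥ j≮p) = s≤s i<j

skip-cancel-< : ∀ p → skip p i < skip p j → i < j
skip-cancel-< {i} {j} p lt with <-cmp i j
... | tri< i<j _ _ = i<j
... | tri≈ _ refl _ = contradiction lt (<-irrefl refl)
... | tri> _ _ j<i = contradiction lt (<⇒≯ (skip-mono-< p j<i))

skip-injective : ∀ p → skip p i ≡ skip p j → i ≡ j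
skip-injective {i} {j} p eq with <-cmp i j
... | tri< i<j _ _ = contradiction eq (<⇒≢ (skip-mono-< p i<j))
... | tri≈ _ i≡j _ = i≡j
... | tri> _ _ j<i = contradiction eq (>⇒≢ (skip-mono-< p j<i))

insert : ℕ → (ℕ → A) → A → ℕ → A
insert p g x t = if t <ᵇ p then g t else (if t ≡ᵇ p then x else g (t ∸ 1))

-- Position t of a chain with one extra entry inserted at gap p holds chain entry i (just i) or the
-- extra entry (nothing); rank p is the inverse map.
slot : ℕ → ℕ → Maybe ℕ
slot p = insert p just nothing

rank : ℕ → Maybe ℕ → ℕ
rank q = maybe′ (skip q) q

slot-< : t < p → slot p t ≡ just t
slot-< t<p rewrite <ᵇ-true t<p = refl

slot-≡ : ∀ p → slot p p ≡ nothing
slot-≡ p rewrite <ᵇ-false (≤-refl {p}) | ≡ᵇ-refl p = refl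

slot-> : p < t → slot p t ≡ just (t ∸ 1)
slot-> p<t rewrite <ᵇ-false (<⇒≤ p<t) | ≡ᵇ-false (>⇒≢ p<t) = refl

insert-slot : ∀ p (g : ℕ → A) x t → insert p g x t ≡ maybe′ g x (slot p t)
insert-slot {A = A} p g x t =
  sym (trans (if-float h (t <ᵇ p)) (cong (if t <ᵇ p then g t else_) (if-float h (t ≡ᵇ p))))
  where
  h : Maybe ℕ → A
  h = maybe′ g x

rank-slot : ∀ p t → rank p (slot p t) ≡ t
rank-slot p t with <-cmp t p
... | tri< t<p _ _ = trans (cong (rank p) (slot-< t<p)) (skip-below t<p)
... | tri≈ _ refl _ = cong (rank p) (slot-≡ p)
rank-slot p (suc t) | tri> _ _ p<1+t =
  trans (cong (rank p) (slot-> p<1+t)) (skip-above (s≤s⁻¹ p<1+t))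

slot-rank : ∀ p α → slot p (rank p α) ≡ α
slot-rank p nothing = slot-≡ p
slot-rank p (just i) with i <? p
... | yes i<p rewrite skip-below i<p = slot-< i<p
... | no  i≮p rewrite skip-above (≮⇒≥ i≮p) = slot-> (s≤s (≮⇒≥ i≮p))

slot-bounded : p ≤ m → t ≤ m → All (_< m) (slot p t)
slot-bounded {p} {m} {t} p≤m t≤m with <-cmp t p
... | tri< t<p _ _ = subst (All (_< m)) (sym (slot-< t<p)) (just (<-≤-trans t<p p≤m))
... | tri≈ _ refl _ = subst (All (_< m)) (sym (slot-≡ p)) nothing
slot-bounded {m = m} {t = suc t} p≤m t<m | tri> _ _ p<1+t =
  subst (All (_< m)) (sym (slot-> p<1+t)) (just t<m)

rank≤ : q ≤ m → All (_< m) α → rank q α ≤ m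
rank≤ {q} q≤m (just {i} i<m) = ≤-trans (skip≤suc q i) i<m
rank≤ q≤m nothing = q≤m

rank-injective : ∀ q α β → rank q α ≡ rank q β → α ≡ β
rank-injective q (just i) (just j) eq = cong just (skip-injective q eq)
rank-injective q (just i) nothing eq = contradiction eq skip≢pivot
rank-injective q nothing (just j) eq = contradiction (sym eq) skip≢pivot
rank-injective q nothing nothing eq = refl

Increasing : (A → ℕ) → ℕ → (ℕ → A) → Set
Increasing f m s = ∀ {i j} → i < j → j < m → f (s i) < f (s j)

Increasing⇒mono-≤ : Increasing f m s → i ≤ j → j < m → f (s i) ≤ f (s j)
Increasing⇒mono-≤ inc i≤j j<m with m≤n⇒m<n∨m≡n i≤j
... | inj₁ i<j  = <⇒≤ (inc i<j j<m)
... | inj₂ refl = ≤-refl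

record Slotted (f : A → ℕ) (m : ℕ) (s : ℕ → A) (e : A) (q : ℕ) : Set where
  field
    increasing : Increasing f m s
    below      : ∀ {i} → i < q → f (s i) < f e
    above      : ∀ {i} → q ≤ i → i < m → f e < f (s i)
open Slotted

Slotted⇒≢ : Slotted f m s e q → i < m → f (s i) ≢ f e
Slotted⇒≢ {q = q} {i = i} S i<m with i <? q
... | yes i<q = <⇒≢ (below S i<q)
... | no  i≮q = >⇒≢ (above S (≮⇒≥ i≮q) i<m)

Slotted⇒rank-mono : Slotted f m s e q → All (_< m) α → All (_< m) β →
  rank q α < rank q β → f (maybe′ s e α) < f (maybe′ s e β)
Slotted⇒rank-mono {q = q} S (just _) (just j<m) lt = increasing S (skip-cancel-< q lt) j<m
Slotted⇒rank-mono S (just _) nothing lt = below S (skip-<-pivot⁻¹ lt)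
Slotted⇒rank-mono S nothing (just j<m) lt = above S (pivot-<-skip⁻¹ lt) j<m
Slotted⇒rank-mono S nothing nothing lt = contradiction lt (<-irrefl refl)

rank-mono⇒Slotted : ∀ {g : Maybe ℕ → A} → q ≤ m →
  (∀ {α β} → All (_< m) α → All (_< m) β → rank q α < rank q β → f (g α) < f (g β)) →
  Slotted f m (g ∘ just) (g nothing) q
rank-mono⇒Slotted {q = q} q≤m mono = record
  { increasing = λ i<j j<m → mono (just (<-trans i<j j<m)) (just j<m) (skip-mono-< q i<j)
  ; below      = λ i<q → mono (just (<-≤-trans i<q q≤m)) nothing (skip-<-pivot i<q)
  ; above      = λ q≤i i<m → mono nothing (just i<m) (pivot-<-skip q≤i)
  }

Slotted-between : Slotted f m s e q → q < m → f e ≤ f x → f x < f (s q) → Slotted f m s x q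
Slotted-between {f = f} {s = s} S q<m e≤x x<sq = record
  { increasing = increasing S
  ; below      = λ i<q → <-≤-trans (below S i<q) e≤x
  ; above      = λ q≤i i<m → <-≤-trans x<sq (Increasing⇒mono-≤ {f = f} {s = s} (increasing S) q≤i i<m)
  }

find-gap : Increasing f m s → (∀ {i} → i < m → f (s i) ≢ f e) →
  Σ ℕ λ q → q ≤ m × Slotted f m s e q
find-gap {f = f} {m = m} {s = s} {e = e} inc distinct with search m ≤-refl
  where
  search : ∀ r → r ≤ m → Σ ℕ λ q → q ≤ r × (∀ {i} → i < q → f (s i) < f e) ×
                                  (∀ {i} → q ≤ i → i < r → f e < f (s i))
  search zero _ = zero , z≤n , (λ ()) , (λ _ ())
  search (suc r) r<m with search r (<⇒≤ r<m) | <-cmp (f (s r)) (f e)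
  ... | _ | tri≈ _ sr≡e _ = contradiction sr≡e (distinct r<m)
  ... | q , q≤r , B , A | tri> _ _ e<sr = q , m≤n⇒m≤1+n q≤r , B , A′
    where
    A′ : ∀ {i} → q ≤ i → i < suc r → f e < f (s i)
    A′ q≤i i<1+r with m≤n⇒m<n∨m≡n (s≤s⁻¹ i<1+r)
    ... | inj₁ i<r  = A q≤i i<r
    ... | inj₂ refl = e<sr
  ... | q , q≤r , B , A | tri< sr<e _ _ =
    suc r , ≤-refl , B′ , λ r<i i<1+r → contradiction r<i (<⇒≱ i<1+r)
    where
    B′ : ∀ {i} → i < suc r → f (s i) < f e
    B′ {i} i<1+r with m≤n⇒m<n∨m≡n (s≤s⁻¹ i<1+r) | i <? q
    ... | inj₂ refl | _       = sr<e
    ... | inj₁ _    | yes i<q = B i<q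
    ... | inj₁ i<r  | no  i≮q = contradiction (<-trans (A (≮⇒≥ i≮q) i<r) (inc i<r r<m)) (<-asym sr<e)
... | q , q≤m , B , A = q , q≤m , record { increasing = inc ; below = B ; above = A }

update : (ℕ → A) → ℕ → A → ℕ → A
update s q x i = if i ≡ᵇ q then x else s i

update-≡ : ∀ s q (x : A) → update s q x q ≡ x
update-≡ s q x rewrite ≡ᵇ-refl q = refl

update-≢ : ∀ s (x : A) → i ≢ q → update s q x i ≡ s i
update-≢ s x i≢q rewrite ≡ᵇ-false i≢q = refl

update-increasing : Slotted f m s x q → Increasing f m (update s q x)
update-increasing {s = s} {x = x} {q = q} S {i} {j} i<j j<m with i ≟ q | j ≟ q
... | yes refl | yes refl = contradiction i<j (<-irrefl refl)
... | yes refl | no  j≢q rewrite update-≡ s q x | update-≢ s x j≢q =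
  above S (<⇒≤ i<j) j<m
... | no  i≢q | yes refl rewrite update-≡ s q x | update-≢ s x i≢q =
  below S i<j
... | no  i≢q | no  j≢q rewrite update-≢ s x i≢q | update-≢ s x j≢q =
  increasing S i<j j<m

Slotted-update : Slotted f m s e q → Slotted f m s x q → f e < f x → Slotted f m (update s q x) e q
Slotted-update {f = f} {m = m} {s = s} {e = e} {q = q} {x = x} Se Sx e<x = record
  { increasing = update-increasing Sx
  ; below      = below′
  ; above      = above′
  }
  where
  below′ : ∀ {i} → i < q → f (update s q x i) < f e
  below′ i<q rewrite update-≢ s x (<⇒≢ i<q) = below Se i<q
  above′ : ∀ {i} → q ≤ i → i < m → f e < f (update s q x i)
  above′ {i} q≤i i<m with i ≟ q
  ... | yes refl rewrite update-≡ s q x = e<x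
  ... | no  i≢q rewrite update-≢ s x i≢q = above Se q≤i i<m

Slotted-update-gap : ∀ {k} → k < m → Slotted f m s e q → Slotted f m s x k →
  Slotted f m (update s k x) e k → q ≡ k
Slotted-update-gap {f = f} {s = s} {e = e} {q = q} {x = x} {k = k} k<m Se Sx Su with <-cmp q k
... | tri< q<k _ _ = contradiction
  (subst (λ y → f y < f e) (update-≢ s x (<⇒≢ q<k)) (below Su q<k))
  (<⇒≯ (above Se ≤-refl (<-trans q<k k<m)))
... | tri≈ _ q≡k _ = q≡k
... | tri> _ _ k<q = contradiction
  (<-trans (subst (λ y → f e < f y) (update-≡ s k x) (above Su ≤-refl k<m)) (above Sx ≤-refl k<m))
  (<⇒≯ (below Se k<q))

order-iso : (g h : A → ℕ) →
  (∀ {a b} → g a < g b → h a < h b) → (∀ {a b} → g a ≡ g b → h a ≡ h b) →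
  ∀ a b → (g a < g b) ⇔ (h a < h b)
order-iso g h mono resp a b = mk⇔ mono reflect
  where
  reflect : h a < h b → g a < g b
  reflect ha<hb with <-cmp (g a) (g b)
  ... | tri< ga<gb _ _ = ga<gb
  ... | tri≈ _ ga≡gb _ = contradiction ha<hb (<-irrefl (resp ga≡gb))
  ... | tri> _ _ gb<ga = contradiction ha<hb (<⇒≯ (mono gb<ga))

occurrence-≡ : ∀ {n k} {π : Perm n} {ρ : Fin k → ℕ} (o : Occurrence π ρ) {a b} →
  ρ a ≡ ρ b → val π (pos o a) ≡ val π (pos o b)
occurrence-≡ o {a} {b} ρa≡ρb = ≤-antisym
  (≮⇒≥ λ lt → <-irrefl (sym ρa≡ρb) (Equivalence.from (orderIso o b a) lt))
  (≮⇒≥ λ lt → <-irrefl ρa≡ρb (Equivalence.from (orderIso o a b) lt))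

clamp : ∀ m → ℕ → Fin (suc m)
clamp m t = fromℕ< (s≤s (m⊓n≤n t m))

toℕ-clamp : t ≤ m → toℕ (clamp m t) ≡ t
toℕ-clamp t≤m = trans (Fin.toℕ-fromℕ< _) (m≤n⇒m⊓n≡m t≤m)

module Embedding {n : ℕ} (π : Perm n) (k b : ℕ) where

  len : ℕ
  len = k + suc b

  k<len : k < len
  k<len = m<m+n k z<s

  Pattern : ℕ → Fin (suc len) → ℕ
  Pattern p = shufflePat (suc k) (suc b) p

  pattern-slot : ∀ p t → insertAt (suc k) p t ≡ suc (rank k (slot p t))
  pattern-slot p t = trans (insert-slot p (skipVal (suc k)) (suc k) t) (role (slot p t))
    where
    role : ∀ α → maybe′ (skipVal (suc k)) (suc k) α ≡ suc (rank k α)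
    role (just i) = sym (if-float suc (i <ᵇ k))
    role nothing  = refl

  slot-clamp-rank : p ≤ len → All (_< len) α → slot p (toℕ (clamp len (rank p α))) ≡ α
  slot-clamp-rank {p} {α} p≤len bα = trans (cong (slot p) (toℕ-clamp (rank≤ p≤len bα))) (slot-rank p α)

  pattern-clamp-rank : p ≤ len → All (_< len) α → Pattern p (clamp len (rank p α)) ≡ suc (rank k α)
  pattern-clamp-rank {p} p≤len bα = trans (pattern-slot p _) (cong (suc ∘ rank k) (slot-clamp-rank p≤len bα))

  -- chain k plays a and extra plays a − 1; the gap p = k is excluded by the definition of Π.
  record Config (p : ℕ) : Set where
    field
      chain     : ℕ → Fin n
      extra     : Fin n
      positions : Slotted toℕ len chain extra p
      values    : Slotted (val π) len chain extra k
  open Config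

  occurrence : p ≤ len → Config p → Occurrence π (Pattern p)
  occurrence {p} p≤len K = record
    { pos      = entry ∘ slot p ∘ toℕ
    ; incr     = λ u v u<v → Slotted⇒rank-mono (positions K) (bounded u) (bounded v)
                   (subst₂ _<_ (sym (rank-slot p (toℕ u))) (sym (rank-slot p (toℕ v))) u<v)
    ; orderIso = order-iso (Pattern p) (val π ∘ entry ∘ slot p ∘ toℕ) mono respects-≡
    }
    where
    entry : Maybe ℕ → Fin n
    entry = maybe′ (chain K) (extra K)
    bounded : (u : Fin (suc len)) → All (_< len) (slot p (toℕ u))
    bounded u = slot-bounded p≤len (s≤s⁻¹ (Fin.toℕ<n u))
    mono : ∀ {u v} → Pattern p u < Pattern p v →
      val π (entry (slot p (toℕ u))) < val π (entry (slot p (toℕ v)))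
    mono {u} {v} lt = Slotted⇒rank-mono (values K) (bounded u) (bounded v)
      (s<s⁻¹ (subst₂ _<_ (pattern-slot p (toℕ u)) (pattern-slot p (toℕ v)) lt))
    respects-≡ : ∀ {u v} → Pattern p u ≡ Pattern p v →
      val π (entry (slot p (toℕ u))) ≡ val π (entry (slot p (toℕ v)))
    respects-≡ {u} {v} eq = cong (val π ∘ entry) (rank-injective k (slot p (toℕ u)) (slot p (toℕ v))
      (suc-injective (trans (sym (pattern-slot p (toℕ u))) (trans eq (pattern-slot p (toℕ v))))))

  occurrence-role : (p≤len : p ≤ len) (K : Config p) → All (_< len) α →
    Σ (Fin (suc len)) λ a → Pattern p a ≡ suc (rank k α) ×
      val π (pos (occurrence p≤len K) a) ≡ val π (maybe′ (chain K) (extra K) α)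
  occurrence-role {p} {α} p≤len K bα = clamp len (rank p α) , pattern-clamp-rank p≤len bα ,
    cong (val π ∘ maybe′ (chain K) (extra K)) (slot-clamp-rank p≤len bα)

  configuration : p ≤ len → Occurrence π (Pattern p) → Config p
  configuration {p} p≤len o = record
    { chain     = λ i → at (skip p i)
    ; extra     = at p
    ; positions = rank-mono⇒Slotted {g = at ∘ rank p} p≤len λ bα bβ lt →
        incr o _ _
          (subst₂ _<_ (sym (toℕ-clamp (rank≤ p≤len bα))) (sym (toℕ-clamp (rank≤ p≤len bβ))) lt)
    ; values    = rank-mono⇒Slotted {g = at ∘ rank p} (<⇒≤ k<len) λ bα bβ lt →
        Equivalence.to (orderIso o _ _)
          (subst₂ _<_ (sym (pattern-clamp-rank p≤len bα)) (sym (pattern-clamp-rank p≤len bβ)) (s<s lt))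
    }
    where
    at : ℕ → Fin n
    at t = pos o (clamp len t)

  record Witness (x y : ℕ) : Set where
    field
      gap     : ℕ
      gap≤len : gap ≤ len
      gap≢k   : gap ≢ k
      config  : Config gap
      chain-k : val π (chain config k) ≡ x
      extra≡  : val π (extra config) ≡ y

  module _ {x y : ℕ} (W : Witness x y) where
    open Witness W

    private
      role-a : Σ (Fin (suc len)) λ j →
        Pattern gap j ≡ suc (suc k) × val π (pos (occurrence gap≤len config) j) ≡ x
      role-a with occurrence-role gap≤len config (just k<len)
      ... | j , ρj , vj = j , trans ρj (cong suc (skip-above ≤-refl)) , trans vj chain-k

      role-a-1 : Σ (Fin (suc len)) λ j →
        Pattern gap j ≡ suc k × val π (pos (occurrence gap≤len config) j) ≡ y
      role-a-1 with occurrence-role gap≤len config nothing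
      ... | j , ρj , vj = j , ρj , trans vj extra≡

    witness⇒assocWith : AssocWith π (suc (suc k)) b x y
    witness⇒assocWith = gap , (s≤s gap≤len , gap≢k) , occurrence gap≤len config , role-a , role-a-1

    witness⇒playsA : PlaysA π (suc (suc k)) b x
    witness⇒playsA = gap , (s≤s gap≤len , gap≢k) , occurrence gap≤len config , role-a , role-a

    witness⇒< : y < x
    witness⇒< = subst₂ _<_ extra≡ chain-k (above (values config) ≤-refl k<len)

  assocWith⇒witness : ∀ {x y} → AssocWith π (suc (suc k)) b x y → Witness x y
  assocWith⇒witness (p , (p<1+len , p≢k) , o , (ja , ρja , vja) , (jc , ρjc , vjc)) = record
    { gap     = p
    ; gap≤len = p≤len
    ; gap≢k   = p≢k
    ; config  = configuration p≤len o
    ; chain-k = trans (sym (role (just k<len) (trans ρja (cong suc (sym (skip-above ≤-refl)))))) vja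
    ; extra≡  = trans (sym (role nothing ρjc)) vjc
    }
    where
    p≤len : p ≤ len
    p≤len = s≤s⁻¹ p<1+len
    role : ∀ {j α} → All (_< len) α → Pattern p j ≡ suc (rank k α) →
      val π (pos o j) ≡ val π (pos o (clamp len (rank p α)))
    role bα ρj = occurrence-≡ o (trans ρj (sym (pattern-clamp-rank p≤len bα)))

  toℕ-distinct : ∀ {s : ℕ → Fin n} {e q} → Slotted (val π) len s e q →
    ∀ {i} → i < len → toℕ (s i) ≢ toℕ e
  toℕ-distinct S i<len = Slotted⇒≢ S i<len ∘ cong (val π) ∘ Fin.toℕ-injective

  module _ {ua ua1 : ℕ} (ua-min : ∀ {x} → PlaysA π (suc (suc k)) b x → ua ≤ x) (W : Witness ua ua1) where
    open Witness W

    swap-impossible : ∀ i → ua1 < val π i → val π i < ua →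
      Slotted toℕ len (chain config) i k → Slotted (val π) len (chain config) i k → ⊥
    swap-impossible i ua1<v v<ua poss vals = by-gap (find-gap (update-increasing poss) (toℕ-distinct values′))
      where
      swapped : ℕ → Fin n
      swapped = update (chain config) k i
      values′ : Slotted (val π) len swapped (extra config) k
      values′ = Slotted-update (values config) vals (subst (_< val π i) (sym extra≡) ua1<v)
      by-gap : Σ ℕ (λ p → p ≤ len × Slotted toℕ len swapped (extra config) p) → ⊥
      by-gap (p , p≤len , poss′) with p ≟ k
      ... | yes refl = gap≢k (Slotted-update-gap k<len (positions config) poss poss′)
      ... | no  p≢k  = <⇒≱ v<ua (ua-min (witness⇒playsA record
        { gap = p ; gap≤len = p≤len ; gap≢k = p≢k
        ; config  = record { chain = swapped ; extra = extra config ; positions = poss′ ; values = values′ }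
        ; chain-k = cong (val π) (update-≡ (chain config) k i)
        ; extra≡  = extra≡
        }))

    interval⇒assocWith : ∀ i → ua1 ≤ val π i → val π i ≤ ua ∸ 1 →
      AssocWith π (suc (suc k)) b ua (val π i)
    interval⇒assocWith i ua1≤v v≤ua-1 =
      by-gap (find-gap (increasing (positions config)) (toℕ-distinct values′))
      where
      v<ua : val π i < ua
      v<ua = subst (λ u → val π i ≤ u ∸ 1 → val π i < u) chain-k s≤s v≤ua-1
      values′ : Slotted (val π) len (chain config) i k
      values′ = Slotted-between (values config) k<len
        (subst (_≤ val π i) (sym extra≡) ua1≤v) (subst (val π i <_) (sym chain-k) v<ua)
      by-gap : Σ ℕ (λ p → p ≤ len × Slotted toℕ len (chain config) i p) →
        AssocWith π (suc (suc k)) b ua (val π i)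
      by-gap (p , p≤len , poss) with p ≟ k | ua1 ≟ val π i
      ... | no p≢k | _ = witness⇒assocWith record
        { gap = p ; gap≤len = p≤len ; gap≢k = p≢k
        ; config  = record { chain = chain config ; extra = i ; positions = poss ; values = values′ }
        ; chain-k = chain-k
        ; extra≡  = refl
        }
      ... | yes _ | yes ua1≡v = subst (AssocWith π (suc (suc k)) b ua) ua1≡v (witness⇒assocWith W)
      ... | yes refl | no ua1≢v = ⊥-elim (swap-impossible i (≤∧≢⇒< ua1≤v ua1≢v) v<ua poss values′)

lemma2p2 : (a b n : ℕ) → 2 ≤ a → (π : Perm n) → ContainsΠ π (a ∸ 1) (suc b) →
    (ua : ℕ) → IsMin (PlaysA π a b) ua →
    (ua1 : ℕ) → IsMin (AssocWith π a b ua) ua1 →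
    (i : Fin n) → AssocWith π a b ua (val π i) ⇔ ((ua1 ≤ val π i) × (val π i ≤ ua ∸ 1))
lemma2p2 (suc (suc k)) b n _ π _ ua (_ , ua-min) ua1 (ua1-assoc , ua1-min) i = mk⇔
  (λ assoc → ua1-min _ assoc , <⇒≤pred (witness⇒< (assocWith⇒witness assoc)))
  (λ (ua1≤v , v≤ua-1) → interval⇒assocWith (ua-min _) (assocWith⇒witness ua1-assoc) i ua1≤v v≤ua-1)
  where open Embedding π k b
lemma2p2 (suc zero) _ _ (s≤s ()) _ _ _ _ _ _ _
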